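{- Let $i\ge 1$ and let $X$ be a fresh symbol. (1) Replacing all occurrences of $\mathtt{ba}$ in $F_{2i}^{(\mathtt{a},\mathtt{b})}$ by $X$ yields $P_i^{(\mathtt{a},X)}$. (2) Replacing all occurrences of $\mathtt{ab}$ in $Q_i^{(\mathtt{a},\mathtt{b})}$ by $X$ yields $P_i^{(\mathtt{a},X)}$. (3) Replacing all occurrences of $\mathtt{ab}$ in $P_{i+1}^{(\mathtt{a},\mathtt{b})}$ by $X$ yields $Q_i^{(X,\mathtt{b})}$.
   Context: For distinct symbols $a,b$: $F_1^{(a,b)}=b$, $F_2^{(a,b)}=a$, $F_i^{(a,b)}=F_{i-1}^{(a,b)}F_{i-2}^{(a,b)}$ for $i\ge 3$; $\pi^{(a,b)}$ is the morphism $a\mapsto ab$, $b\mapsto abb$; $\theta^{(a,b)}$ is the morphism $a\mapsto aab$, $b\mapsto ab$; $P_i^{(a,b)}=(\pi^{(a,b)})^{i-1}(a)$ and $Q_i^{(a,b)}=(\theta^{(a,b)})^{i-1}(a)$. (Occurrences of $\mathtt{ab}$ and of $\mathtt{ba}$ cannot overlap, so the replacements are well defined.) -}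

module Defs where

open import Data.Nat using (ℕ; zero; suc; _∸_)
open import Data.Bool using (Bool; true; false; _∧_; if_then_else_)
open import Data.List using (List; []; _∷_; _++_; concatMap)

data Sym : Set where
  a b X : Sym

Word : Set
Word = List Sym

_==_ : Sym → Sym → Bool
a == a = true
b == b = true
X == X = true
_ == _ = false

-- Fibonacci words: F 1 = s , F 2 = r , F i = F (i-1) ++ F (i-2),
-- where (r , s) plays the role of (a , b) in F^(a,b).  F 0 is unused.
F : Sym → Sym → ℕ → Word
F r s zero = []
F r s (suc zero) = s ∷ []
F r s (suc (suc zero)) = r ∷ []
F r s (suc (suc (suc n))) = F r s (suc (suc n)) ++ F r s (suc n)

applyMorph : (Sym → Word) → Word → Word
applyMorph h w = concatMap h w

π : Sym → Sym → Sym → Word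
π r s c = if c == r then r ∷ s ∷ [] else (if c == s then r ∷ s ∷ s ∷ [] else c ∷ [])

θ : Sym → Sym → Sym → Word
θ r s c = if c == r then r ∷ r ∷ s ∷ [] else (if c == s then r ∷ s ∷ [] else c ∷ [])

iter : ℕ → (Word → Word) → Word → Word
iter zero f w = w
iter (suc n) f w = f (iter n f w)

P : Sym → Sym → ℕ → Word
P r s i = iter (i ∸ 1) (applyMorph (π r s)) (r ∷ [])

Q : Sym → Sym → ℕ → Word
Q r s i = iter (i ∸ 1) (applyMorph (θ r s)) (r ∷ [])

-- replace every occurrence of the two-letter factor c d by X,
-- scanning left to right (occurrences cannot overlap when c ≠ d).
replace : Sym → Sym → Word → Word
replace c d [] = []
replace c d (x ∷ []) = x ∷ []
replace c d (x ∷ y ∷ w) =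
  if (x == c) ∧ (y == d) then X ∷ replace c d w else x ∷ replace c d (y ∷ w)

-- Let  expand c d  be the substitution X ↦ cd.  On a word over {e, X} with e ∈ {c, d}
-- and c ≠ d, every factor cd of its image comes from an X, so replacing cd by X undoes
-- the expansion.  On the relevant two-letter alphabets, expansion conjugates
-- π^(a,X) to the square of the Fibonacci morphism φ (a ↦ ab, b ↦ a) and to θ^(a,b),
-- and θ^(X,b) to π^(a,b).  Iterating from a (resp. from X, whose expansion ab is
-- π^(a,b)(a)) and using F_{2i} = φ^{2i-2}(a) gives the three identities.
module Submission where

open import Defs
open import Data.Nat using (ℕ; suc; zero; _*_; _≥_; _+_)
open import Data.Nat.Properties using (+-suc; +-identityʳ)
open import Data.Product using (_×_; _,_)
open import Data.List using (List; []; _∷_; _++_; concatMap)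
open import Data.List.Properties using (concatMap-++)
open import Data.List.Effectful using (module MonadProperties)
open import Data.List.Relation.Unary.All using (All; []; _∷_)
open import Data.List.Relation.Unary.All.Properties using (++⁺)
open import Function using (_∘_)
open import Relation.Binary.PropositionalEquality
open ≡-Reasoning

module _ {A : Set} {Q : A → Set} where

  All-concatMap : {h : A → List A} → (∀ {x} → Q x → All Q (h x))
    → ∀ {w} → All Q w → All Q (concatMap h w)
  All-concatMap hQ [] = []
  All-concatMap hQ (q ∷ qs) = ++⁺ (hQ q) (All-concatMap hQ qs)

  concatMap-intertwine : {B : Set} (β : A → List B) (h : A → List A) (g : B → List B)
    → (∀ {x} → Q x → concatMap β (h x) ≡ concatMap g (β x))
    → ∀ {w} → All Q w → concatMap β (concatMap h w) ≡ concatMap g (concatMap β w)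
  concatMap-intertwine β h g βh≡gβ [] = refl
  concatMap-intertwine β h g βh≡gβ {x ∷ w} (q ∷ qs) = begin
    concatMap β (h x ++ concatMap h w)                  ≡⟨ concatMap-++ β (h x) _ ⟩
    concatMap β (h x) ++ concatMap β (concatMap h w)    ≡⟨ cong₂ _++_ (βh≡gβ q) (concatMap-intertwine β h g βh≡gβ qs) ⟩
    concatMap g (β x) ++ concatMap g (concatMap β w)    ≡⟨ concatMap-++ g (β x) _ ⟨
    concatMap g (β x ++ concatMap β w)                  ∎

iter-preserves : {Q : Word → Set} {h : Word → Word} → (∀ {w} → Q w → Q (h w))
  → ∀ n {w} → Q w → Q (iter n h w)
iter-preserves hQ zero q = q
iter-preserves {Q} {h} hQ (suc n) q = hQ (iter-preserves {Q} {h} hQ n q)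

iter-intertwine : {Q : Word → Set} (f h g : Word → Word)
  → (∀ {w} → Q w → Q (h w)) → (∀ {w} → Q w → f (h w) ≡ g (f w))
  → ∀ n {w} → Q w → f (iter n h w) ≡ iter n g (f w)
iter-intertwine f h g hQ fh≡gf zero q = refl
iter-intertwine {Q} f h g hQ fh≡gf (suc n) {w} q = begin
  f (h (iter n h w))   ≡⟨ fh≡gf (iter-preserves {Q} hQ n q) ⟩
  g (f (iter n h w))   ≡⟨ cong g (iter-intertwine {Q} f h g hQ fh≡gf n q) ⟩
  g (iter n g (f w))   ∎

iter-suc-inner : (f : Word → Word) (n : ℕ) (w : Word) → iter (suc n) f w ≡ iter n f (f w)
iter-suc-inner f zero w = refl
iter-suc-inner f (suc n) w = cong f (iter-suc-inner f n w)

iter-morphism-intertwine : {Q : Sym → Set} (β h g : Sym → Word)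
  → (∀ {x} → Q x → All Q (h x))
  → (∀ {x} → Q x → concatMap β (h x) ≡ concatMap g (β x))
  → ∀ n {w} → All Q w
  → concatMap β (iter n (applyMorph h) w) ≡ iter n (applyMorph g) (concatMap β w)
iter-morphism-intertwine {Q} β h g hQ βh≡gβ =
  iter-intertwine {All Q} (concatMap β) (applyMorph h) (applyMorph g)
    (All-concatMap hQ) (concatMap-intertwine β h g βh≡gβ)

expand : Sym → Sym → Sym → Word
expand c d X = c ∷ d ∷ []
expand c d x = x ∷ []

data Over (e : Sym) : Sym → Set where
  letter : Over e e
  fresh  : Over e X

-- The three admissible (c, d, e): e ∈ {c, d} and c ≠ d, so neither ee nor ec is cd.
data Admissible : Sym → Sym → Sym → Set where
  ba-a : Admissible b a a
  ab-a : Admissible a b a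
  ab-b : Admissible a b b

replace-expand : ∀ {c d e} → Admissible c d e
  → ∀ {w} → All (Over e) w → replace c d (concatMap (expand c d) w) ≡ w
replace-expand κ [] = refl
replace-expand ba-a (fresh ∷ qs) = cong (X ∷_) (replace-expand ba-a qs)
replace-expand ba-a (letter ∷ []) = refl
replace-expand ba-a (letter ∷ letter ∷ qs) = cong (a ∷_) (replace-expand ba-a (letter ∷ qs))
replace-expand ba-a (letter ∷ fresh ∷ qs) = cong (a ∷_) (replace-expand ba-a (fresh ∷ qs))
replace-expand ab-a (fresh ∷ qs) = cong (X ∷_) (replace-expand ab-a qs)
replace-expand ab-a (letter ∷ []) = refl
replace-expand ab-a (letter ∷ letter ∷ qs) = cong (a ∷_) (replace-expand ab-a (letter ∷ qs))
replace-expand ab-a (letter ∷ fresh ∷ qs) = cong (a ∷_) (replace-expand ab-a (fresh ∷ qs))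
replace-expand ab-b (fresh ∷ qs) = cong (X ∷_) (replace-expand ab-b qs)
replace-expand ab-b (letter ∷ []) = refl
replace-expand ab-b (letter ∷ letter ∷ qs) = cong (b ∷_) (replace-expand ab-b (letter ∷ qs))
replace-expand ab-b (letter ∷ fresh ∷ qs) = cong (b ∷_) (replace-expand ab-b (fresh ∷ qs))

replace-iter-expand : ∀ {c d e} → Admissible c d e → {h g : Sym → Word}
  → (∀ {x} → Over e x → All (Over e) (h x))
  → (∀ {x} → Over e x → concatMap (expand c d) (h x) ≡ concatMap g (expand c d x))
  → ∀ n {w} → All (Over e) w
  → replace c d (iter n (applyMorph g) (concatMap (expand c d) w)) ≡ iter n (applyMorph h) w
replace-iter-expand {c} {d} {e} κ {h} {g} hOver expand-h≡g n {w} qs = begin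
  replace c d (iter n (applyMorph g) (concatMap (expand c d) w))
    ≡⟨ cong (replace c d) (iter-morphism-intertwine (expand c d) h g hOver expand-h≡g n qs) ⟨
  replace c d (concatMap (expand c d) (iter n (applyMorph h) w))
    ≡⟨ replace-expand κ (iter-preserves {All (Over e)} (All-concatMap hOver) n qs) ⟩
  iter n (applyMorph h) w ∎

π-Over : ∀ {x} → Over a x → All (Over a) (π a X x)
π-Over letter = letter ∷ fresh ∷ []
π-Over fresh  = letter ∷ fresh ∷ fresh ∷ []

θ-Over : ∀ {x} → Over b x → All (Over b) (θ X b x)
θ-Over letter = fresh ∷ letter ∷ []
θ-Over fresh  = fresh ∷ fresh ∷ letter ∷ []

fibonacci : Sym → Word
fibonacci a = a ∷ b ∷ []
fibonacci b = a ∷ []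
fibonacci X = X ∷ []

fibonacci² : Sym → Word
fibonacci² = concatMap fibonacci ∘ fibonacci

F-suc : ∀ n → F a b (3 + n) ≡ concatMap fibonacci (F a b (2 + n))
F-suc zero = refl
F-suc (suc zero) = refl
F-suc (suc (suc n)) = begin
  F a b (4 + n) ++ F a b (3 + n)
    ≡⟨ cong₂ _++_ (F-suc (suc n)) (F-suc n) ⟩
  concatMap fibonacci (F a b (3 + n)) ++ concatMap fibonacci (F a b (2 + n))
    ≡⟨ concatMap-++ fibonacci (F a b (3 + n)) _ ⟨
  concatMap fibonacci (F a b (3 + n) ++ F a b (2 + n)) ∎

F-even : ∀ n → F a b (2 + (n + n)) ≡ iter n (applyMorph fibonacci²) (a ∷ [])
F-even zero = refl
F-even (suc n) = begin
  F a b (3 + (n + suc n))                                  ≡⟨ cong (λ k → F a b (3 + k)) (+-suc n n) ⟩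
  F a b (4 + (n + n))                                      ≡⟨ F-suc (1 + (n + n)) ⟩
  concatMap fibonacci (F a b (3 + (n + n)))                ≡⟨ cong (concatMap fibonacci) (F-suc (n + n)) ⟩
  concatMap fibonacci (concatMap fibonacci (F a b (2 + (n + n))))
    ≡⟨ MonadProperties.associative (F a b (2 + (n + n))) fibonacci fibonacci ⟨
  concatMap fibonacci² (F a b (2 + (n + n)))               ≡⟨ cong (concatMap fibonacci²) (F-even n) ⟩
  concatMap fibonacci² (iter n (applyMorph fibonacci²) (a ∷ [])) ∎

expand-π-fibonacci² : ∀ {x} → Over a x
  → concatMap (expand b a) (π a X x) ≡ concatMap fibonacci² (expand b a x)
expand-π-fibonacci² letter = refl
expand-π-fibonacci² fresh  = refl

expand-π-θ : ∀ {x} → Over a x → concatMap (expand a b) (π a X x) ≡ concatMap (θ a b) (expand a b x)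
expand-π-θ letter = refl
expand-π-θ fresh  = refl

expand-θ-π : ∀ {x} → Over b x → concatMap (expand a b) (θ X b x) ≡ concatMap (π a b) (expand a b x)
expand-θ-π letter = refl
expand-θ-π fresh  = refl

double-suc : ∀ n → 2 * suc n ≡ 2 + (n + n)
double-suc n = cong suc (trans (+-suc n (n + 0)) (cong (suc ∘ (n +_)) (+-identityʳ n)))

corollary2 : (i : ℕ) → i ≥ 1 →
    (replace b a (F a b (2 * i)) ≡ P a X i)
    × (replace a b (Q a b i) ≡ P a X i)
    × (replace a b (P a b (suc i)) ≡ Q X b i)
corollary2 (suc n) _ =
    trans (cong (replace b a) (trans (cong (F a b) (double-suc n)) (F-even n)))
      (replace-iter-expand ba-a π-Over expand-π-fibonacci² n (letter ∷ []))
  , replace-iter-expand ab-a π-Over expand-π-θ n (letter ∷ [])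
  , trans (cong (replace a b) (iter-suc-inner (applyMorph (π a b)) n (a ∷ [])))
      (replace-iter-expand ab-b θ-Over expand-θ-π n (fresh ∷ []))
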